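{- Let $F$ be an elimination forest of a graph $G$ such that for each $u\in V(F)$ the graph $G[\mathsf{desc}_F[u]]$ is connected. If $u,v\in V(F)$ are non-root vertices of $F$ with $\mathsf{parent}_F(u)\ne\mathsf{parent}_F(v)$, then $\mathsf{Reach}_F(u)\ne\mathsf{Reach}_F(v)$.
   Context: For a rooted forest $F$, $u\preceq_F v$ means $u$ lies on the path from $v$ to a root; $\mathsf{desc}_F[u]=\{v:u\preceq_F v\}$; $\mathsf{parent}_F(u)$ is the parent of $u$. An elimination forest of $G$ is a rooted forest $F$ with $V(F)=V(G)$ such that for every edge $uv$ of $G$, $u\preceq_F v$ or $v\preceq_F u$. $\mathsf{Reach}_F(u)$ is the set of vertices outside $\mathsf{desc}_F[u]$ that have a neighbor in $\mathsf{desc}_F[u]$. -}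

module Defs where

open import Data.Nat using (ℕ)
open import Data.Fin using (Fin)
open import Data.Sum using (_⊎_)
open import Data.Maybe using (Maybe; just; nothing)
open import Data.Product using (Σ; ∃; _×_; _,_)
open import Relation.Binary.PropositionalEquality using (_≡_)
open import Relation.Nullary using (¬_)
open import Level using (0ℓ)

record Graph (n : ℕ) : Set₁ where
  field
    Adj    : Fin n → Fin n → Set
    sym    : ∀ {x y} → Adj x y → Adj y x
    irrefl : ∀ {x} → ¬ Adj x x

-- A rooted forest on vertex set Fin n given by its parent function
-- (nothing = root).
Parent : ℕ → Set
Parent n = Fin n → Maybe (Fin n)

-- u ⪯ v : u lies on the path from v to its root (reflexive).
data _⊢_⪯_ {n : ℕ} (par : Parent n) : Fin n → Fin n → Set where
  ⪯-refl : ∀ {u} → par ⊢ u ⪯ u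
  ⪯-step : ∀ {u v p} → par v ≡ just p → par ⊢ u ⪯ p → par ⊢ u ⪯ v

record Forest (n : ℕ) : Set where
  field
    parent  : Parent n
    acyclic : ∀ {v p} → parent v ≡ just p → ¬ (parent ⊢ v ⪯ p)

module _ {n : ℕ} where

  _⪯[_]_ : Fin n → Forest n → Fin n → Set
  u ⪯[ F ] v = Forest.parent F ⊢ u ⪯ v

  desc : Forest n → Fin n → Fin n → Set
  desc F u v = u ⪯[ F ] v

  IsEliminationForest : Graph n → Forest n → Set
  IsEliminationForest G F =
    ∀ u v → Graph.Adj G u v → (u ⪯[ F ] v) ⊎ (v ⪯[ F ] u)

  data WalkIn (G : Graph n) (S : Fin n → Set) : Fin n → Fin n → Set where
    here  : ∀ {x} → S x → WalkIn G S x x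
    there : ∀ {x y z} → S x → Graph.Adj G x y → WalkIn G S y z → WalkIn G S x z

  -- G[S] is connected (for the nonempty sets desc_F[u] considered here).
  InducedConnected : Graph n → (Fin n → Set) → Set
  InducedConnected G S = ∀ x y → S x → S y → WalkIn G S x y

  Reach : Graph n → Forest n → Fin n → Fin n → Set
  Reach G F u w = ¬ desc F u w × ∃ λ x → desc F u x × Graph.Adj G w x

{-# OPTIONS --safe #-}
module Submission where

-- Every vertex w of Reach(u) is an ancestor of parent(u): an edge from desc[u]
-- to w makes w comparable with a vertex below u, so w lies on the root path of u.
-- Conversely parent(u) itself belongs to Reach(u), since a walk inside
-- desc[parent(u)] from u to parent(u) must leave desc[u], and the only vertex
-- of desc[parent(u)] it can step to outside desc[u] is parent(u).  So equal
-- reach sets force parent(u) ⪯ parent(v) ⪯ parent(u).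

open import Defs
open import Data.Nat using (ℕ)
open import Data.Fin using (Fin)
open import Data.Maybe using (just)
open import Data.Maybe.Properties using (just-injective)
open import Data.Product using (_×_; _,_; ∃; proj₁; proj₂)
open import Data.Sum using (_⊎_; inj₁; inj₂)
open import Data.Empty using (⊥-elim)
open import Relation.Binary.PropositionalEquality using (_≡_; _≢_; refl; sym; trans)
open import Relation.Nullary using (¬_)

module _ {n : ℕ} (F : Forest n) where
  open Forest F

  ⪯-trans : ∀ {a b c} → a ⪯[ F ] b → b ⪯[ F ] c → a ⪯[ F ] c
  ⪯-trans ab ⪯-refl        = ab
  ⪯-trans ab (⪯-step e bp) = ⪯-step e (⪯-trans ab bp)

  ⪯-antisym : ∀ {a b} → a ⪯[ F ] b → b ⪯[ F ] a → a ≡ b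
  ⪯-antisym ⪯-refl        _  = refl
  ⪯-antisym (⪯-step e ap) ba = ⊥-elim (acyclic e (⪯-trans ba ap))

  ⪯-linear : ∀ {a b x} → a ⪯[ F ] x → b ⪯[ F ] x → a ⪯[ F ] b ⊎ b ⪯[ F ] a
  ⪯-linear ⪯-refl        bx             = inj₂ bx
  ⪯-linear (⪯-step e ap) ⪯-refl         = inj₁ (⪯-step e ap)
  ⪯-linear (⪯-step e ap) (⪯-step e′ bp) rewrite just-injective (trans (sym e) e′) =
    ⪯-linear ap bp

  ⪯⇒≡⊎⪯parent : ∀ {a u p} → parent u ≡ just p → a ⪯[ F ] u → a ≡ u ⊎ a ⪯[ F ] p
  ⪯⇒≡⊎⪯parent e ⪯-refl         = inj₁ refl
  ⪯⇒≡⊎⪯parent e (⪯-step e′ ap) rewrite just-injective (trans (sym e) e′) = inj₂ ap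

walk-source : ∀ {n} {G : Graph n} {S : Fin n → Set} {a b} → WalkIn G S a b → S a
walk-source (here s)      = s
walk-source (there s _ _) = s

module _ {n : ℕ} (G : Graph n) (F : Forest n) (elim : IsEliminationForest G F)
         {u pu : Fin n} (hu : Forest.parent F u ≡ just pu) where

  desc-neighbour : ∀ {x y} → u ⪯[ F ] x → Graph.Adj G x y → u ⪯[ F ] y ⊎ y ⪯[ F ] pu
  desc-neighbour ux adj with elim _ _ adj
  ... | inj₁ xy = inj₁ (⪯-trans F ux xy)
  ... | inj₂ yx with ⪯-linear F ux yx
  ...   | inj₁ uy = inj₁ uy
  ...   | inj₂ yu with ⪯⇒≡⊎⪯parent F hu yu
  ...     | inj₁ refl = inj₁ ⪯-refl
  ...     | inj₂ ypu  = inj₂ ypu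

  Reach⇒⪯parent : ∀ {w} → Reach G F u w → w ⪯[ F ] pu
  Reach⇒⪯parent (¬uw , x , ux , adj) with desc-neighbour ux (Graph.sym G adj)
  ... | inj₁ uw  = ⊥-elim (¬uw uw)
  ... | inj₂ wpu = wpu

  walk-exits-to-parent : ∀ {x t} → WalkIn G (desc F pu) x t → u ⪯[ F ] x → ¬ u ⪯[ F ] t →
                         ∃ λ z → u ⪯[ F ] z × Graph.Adj G pu z
  walk-exits-to-parent (here _)          ux ¬ut = ⊥-elim (¬ut ux)
  walk-exits-to-parent (there _ adj walk) ux ¬ut with desc-neighbour ux adj
  ... | inj₁ uy  = walk-exits-to-parent walk uy ¬ut
  ... | inj₂ ypu with ⪯-antisym F ypu (walk-source walk)
  ...   | refl = _ , ux , Graph.sym G adj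

  parent∈Reach : (∀ v → InducedConnected G (desc F v)) → Reach G F u pu
  parent∈Reach conn = Forest.acyclic F hu ,
    walk-exits-to-parent (conn pu u pu (⪯-step hu ⪯-refl) ⪯-refl) ⪯-refl (Forest.acyclic F hu)

lemma11 : {n : ℕ} (G : Graph n) (F : Forest n) →
    IsEliminationForest G F →
    (∀ u → InducedConnected G (desc F u)) →
    (u v pu pv : Fin n) →
    Forest.parent F u ≡ just pu → Forest.parent F v ≡ just pv → pu ≢ pv →
    ¬ (∀ w → (Reach G F u w → Reach G F v w) × (Reach G F v w → Reach G F u w))
lemma11 G F elim conn u v pu pv hu hv pu≢pv sameReach =
  pu≢pv (⪯-antisym F pu⪯pv pv⪯pu)
  where
    pu⪯pv : pu ⪯[ F ] pv
    pu⪯pv = Reach⇒⪯parent G F elim hv (proj₁ (sameReach pu) (parent∈Reach G F elim hu conn))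
    pv⪯pu : pv ⪯[ F ] pu
    pv⪯pu = Reach⇒⪯parent G F elim hu (proj₂ (sameReach pv) (parent∈Reach G F elim hv conn))
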